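{- Let $G$ be a finite system of nonempty finite sets and let $G'\subseteq G$ consist of those sets in $G$ that are inclusion-minimal in $G$. Then for every integer $r\ge 2$ we have $\chi([G,r])=\chi([G',r])$.
   Context: For a finite system $G$ of nonempty sets and $r\ge2$, the $r$-uniform intersection hypergraph $[G,r]$ has vertex set $G$ and a hyperedge $\{M_1,\dots,M_r\}$ for every $r$ pairwise disjoint sets $M_1,\dots,M_r\in G$. A $k$-coloring of a hypergraph is a map from its vertices to $\{1,\dots,k\}$ such that no hyperedge is monochromatic; $\chi$ is the least such $k$. -}

module Defs where

open import Data.Nat using (ℕ; _<_)
open import Data.Fin using (Fin)
open import Data.Fin.Subset using (Subset; _∈_; _⊆_; Nonempty)
open import Data.List using (List)
import Data.List.Membership.Propositional as LM
open import Data.Product using (_×_; Σ)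
open import Data.Empty using (⊥)
open import Relation.Binary.PropositionalEquality using (_≡_; _≢_)
open import Relation.Nullary using (¬_)

-- A finite set system G over the finite ground set Fin n is a list of subsets
-- of Fin n (duplicates are irrelevant: colourings act on the sets themselves).
SetSystem : ℕ → Set
SetSystem n = List (Subset n)

_∈G_ : ∀ {n} → Subset n → SetSystem n → Set
M ∈G G = LM._∈_ M G

AllNonempty : ∀ {n} → SetSystem n → Set
AllNonempty G = ∀ M → M ∈G G → Nonempty M

Disjoint : ∀ {n} → Subset n → Subset n → Set
Disjoint p q = ∀ x → x ∈ p → x ∈ q → ⊥

Minimal : ∀ {n} → SetSystem n → Subset n → Set
Minimal G M = M ∈G G × (∀ N → N ∈G G → N ⊆ M → N ≡ M)

IsMinimalPart : ∀ {n} → SetSystem n → SetSystem n → Set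
IsMinimalPart G G' = ∀ M → (M ∈G G' → Minimal G M) × (Minimal G M → M ∈G G')

-- hyperedge of [G,r]: r pairwise disjoint members of G
-- (pairwise disjoint nonempty sets are automatically distinct)
IsHyperedge : ∀ {n} → SetSystem n → (r : ℕ) → (Fin r → Subset n) → Set
IsHyperedge G r e = (∀ i → e i ∈G G) × (∀ i j → i ≢ j → Disjoint (e i) (e j))

IsColoring : ∀ {n} → SetSystem n → (r k : ℕ) → (Subset n → Fin k) → Set
IsColoring {n} G r k c =
  ∀ (e : Fin r → Subset n) → IsHyperedge G r e → ¬ (∀ i j → c (e i) ≡ c (e j))

Colorable : ∀ {n} → SetSystem n → (r k : ℕ) → Set
Colorable {n} G r k = Σ (Subset n → Fin k) (IsColoring G r k)

IsChromaticNumber : ∀ {n} → SetSystem n → (r k : ℕ) → Set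
IsChromaticNumber G r k = Colorable G r k × (∀ j → j < k → ¬ Colorable G r j)

-- Every member of G contains an inclusion-minimal member of G, so a colouring of
-- [G',r] pulls back to [G,r] by colouring each set like a minimal set inside it;
-- shrinking sets preserves pairwise disjointness, so hyperedges of [G,r] go to
-- hyperedges of [G',r]. Conversely [G',r] is an induced subhypergraph of [G,r].
-- Hence both hypergraphs are k-colourable for the same k.
module Submission where

open import Defs
open import Data.Nat using (ℕ; _≤_)
open import Data.Product using (_×_; _,_; proj₁; proj₂; ∃)
open import Data.List.Relation.Unary.Any using (any?)
open import Data.List.Membership.Propositional using (find; lose)
open import Data.Fin.Subset using (Subset; _⊆_; _⊂_)
open import Data.Fin.Subset.Properties using (_∈?_; _⊂?_; ⊆-refl; ⊆-trans; ⊆-antisym; p⊂q⇒p⊆q)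
open import Data.Fin.Subset.Induction using (Acc; acc; ⊂-wellFounded)
open import Relation.Nullary using (yes; no; ¬_; contradiction)
open import Relation.Binary.PropositionalEquality using (_≡_)

module _ {n : ℕ} where

  ⊆∧⊄⇒≡ : {p q : Subset n} → p ⊆ q → ¬ p ⊂ q → p ≡ q
  ⊆∧⊄⇒≡ {p} {q} p⊆q p⊄q = ⊆-antisym p⊆q q⊆p
    where
    q⊆p : q ⊆ p
    q⊆p {x} x∈q with x ∈? p
    ... | yes x∈p = x∈p
    ... | no x∉p = contradiction ((λ {_} → p⊆q) , x , x∈q , x∉p) p⊄q

  Disjoint-mono : {p p′ q q′ : Subset n} → p′ ⊆ p → q′ ⊆ q →
                  Disjoint p q → Disjoint p′ q′
  Disjoint-mono p′⊆p q′⊆q p#q x x∈p′ x∈q′ = p#q x (p′⊆p x∈p′) (q′⊆q x∈q′)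

  -- Stated for every M, not only members of G, so that it yields a total
  -- shrinking map: a colouring needs a colour for every set, and k may be 0.
  ⊆-minimal : (G : SetSystem n) (M : Subset n) →
              ∃ λ N → N ⊆ M × (M ∈G G → Minimal G N)
  ⊆-minimal G M = descend M (⊂-wellFounded M)
    where
    descend : ∀ M → Acc _⊂_ M → ∃ λ N → N ⊆ M × (M ∈G G → Minimal G N)
    descend M (acc below) with any? (_⊂? M) G
    ... | yes some⊂M =
      let N , N∈G , N⊂M = find some⊂M
          N′ , N′⊆N , minimal = descend N (below N⊂M)
      in N′ , ⊆-trans N′⊆N (p⊂q⇒p⊆q N⊂M) , λ _ → minimal N∈G
    ... | no none⊂M = M , ⊆-refl , λ M∈G →
      M∈G , λ N N∈G N⊆M → ⊆∧⊄⇒≡ N⊆M (λ N⊂M → none⊂M (lose N∈G N⊂M))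

  module _ {G H : SetSystem n} {r k : ℕ} where

    Colorable-sub : (∀ M → M ∈G H → M ∈G G) → Colorable G r k → Colorable H r k
    Colorable-sub H⊆G (c , proper) =
      c , λ e (e∈H , disjoint) → proper e ((λ i → H⊆G (e i) (e∈H i)) , disjoint)

    Colorable-shrink : (s : Subset n → Subset n) →
                       (∀ M → M ∈G G → s M ∈G H) → (∀ M → s M ⊆ M) →
                       Colorable H r k → Colorable G r k
    Colorable-shrink s s∈H s⊆ (c , proper) =
      (λ M → c (s M)) , λ e (e∈G , disjoint) → proper (λ i → s (e i))
        ( (λ i → s∈H (e i) (e∈G i))
        , λ i j i≢j → Disjoint-mono (s⊆ (e i)) (s⊆ (e j)) (disjoint i j i≢j))

  IsChromaticNumber-transfer : {G H : SetSystem n} {r k : ℕ} →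
    (∀ j → Colorable G r j → Colorable H r j) →
    (∀ j → Colorable H r j → Colorable G r j) →
    IsChromaticNumber G r k → IsChromaticNumber H r k
  IsChromaticNumber-transfer {k = k} G⇒H H⇒G (colorable , optimal) =
    G⇒H k colorable , λ j j<k colH → optimal j j<k (H⇒G j colH)

lemma4p1 : ∀ {n} (G G' : SetSystem n) → AllNonempty G → IsMinimalPart G G' →
    ∀ (r : ℕ) → 2 ≤ r → ∀ (k : ℕ) →
    (IsChromaticNumber G r k → IsChromaticNumber G' r k) ×
    (IsChromaticNumber G' r k → IsChromaticNumber G r k)
lemma4p1 G G' _ G'-minimal r _ k =
  IsChromaticNumber-transfer G⇒G' G'⇒G , IsChromaticNumber-transfer G'⇒G G⇒G'
  where
  G'⊆G : ∀ M → M ∈G G' → M ∈G G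
  G'⊆G M M∈G' = proj₁ (proj₁ (G'-minimal M) M∈G')

  shrink : Subset _ → Subset _
  shrink M = proj₁ (⊆-minimal G M)

  shrink∈G' : ∀ M → M ∈G G → shrink M ∈G G'
  shrink∈G' M M∈G = proj₂ (G'-minimal (shrink M)) (proj₂ (proj₂ (⊆-minimal G M)) M∈G)

  G⇒G' : ∀ j → Colorable G r j → Colorable G' r j
  G⇒G' j = Colorable-sub G'⊆G

  G'⇒G : ∀ j → Colorable G' r j → Colorable G r j
  G'⇒G j = Colorable-shrink shrink shrink∈G' (λ M → proj₁ (proj₂ (⊆-minimal G M)))
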